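{- If $G$ is a connected graph of order $n\geq 5$ and $G$ is not isomorphic to the cycle $C_n$, then, as abstract groups, $Aut(G) \cong Aut(L(G)) \cong Aut(S(G))\cong Aut(C(G))\cong Aut(M(G))$.
   Context: All graphs are simple, finite, undirected; $Aut(H)$ is the automorphism group of $H$. $L(G)$ is the line graph. $S(G)$ is the subdivision graph: vertex set $V(G)\cup\{w_{u,v}:\{u,v\}\in E(G)\}$, edges $\{u,w_{u,v}\},\{w_{u,v},v\}$ for each $\{u,v\}\in E(G)$. $C(G)$ is the central graph: same vertex set as $S(G)$, edges those of $S(G)$ together with all pairs of distinct non-adjacent vertices of $G$. $M(G)$ is the middle graph: vertex set $V(G)\cup E(G)$, with $v\in V(G)$ adjacent to $e\in E(G)$ iff $v$ is an endpoint of $e$, and $e,e'\in E(G)$ adjacent iff they share an endpoint; no two elements of $V(G)$ are adjacent. -}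

module Defs where

open import Data.Nat using (ℕ; zero; suc; _≤_)
open import Data.Fin using (Fin; toℕ; _<_)
open import Data.Bool using (Bool; true; false)
open import Data.Product using (Σ; ∃; _×_; _,_; proj₁; proj₂)
open import Data.Sum using (_⊎_; inj₁; inj₂)
open import Data.Empty using (⊥)
open import Relation.Nullary using (¬_)
open import Relation.Binary.PropositionalEquality using (_≡_)
open import Function.Bundles using (_↔_; Inverse)
open import Function.Base using (_∘_)

record SimpleGraph (n : ℕ) : Set where
  field
    adj   : Fin n → Fin n → Bool
    sym   : ∀ i j → adj i j ≡ adj j i
    irrefl : ∀ i → adj i i ≡ false

open SimpleGraph public

record Graph : Set₁ where
  field
    V    : Set
    _~_  : V → V → Set

open Graph public

⟦_⟧ : ∀ {n} → SimpleGraph n → Graph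
⟦_⟧ {n} G = record { V = Fin n ; _~_ = λ i j → adj G i j ≡ true }

record GraphIso (G H : Graph) : Set where
  field
    bij      : V G ↔ V H
    preserve : ∀ u v → _~_ G u v → _~_ H (Inverse.to bij u) (Inverse.to bij v)
    reflect  : ∀ u v → _~_ H (Inverse.to bij u) (Inverse.to bij v) → _~_ G u v

open GraphIso public

Aut : Graph → Set
Aut G = GraphIso G G

app : ∀ {G} → Aut G → V G → V G
app σ = Inverse.to (bij σ)

_≈A_ : ∀ {G} → Aut G → Aut G → Set
_≈A_ {G} σ τ = ∀ (x : V G) → app σ x ≡ app τ x

_∘A_ : ∀ {G} → Aut G → Aut G → Aut G
_∘A_ {G} σ τ = record
  { bij = record
      { to = app σ ∘ app τ
      ; from = Inverse.from (bij τ) ∘ Inverse.from (bij σ)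
      ; to-cong = λ { _≡_.refl → _≡_.refl }
      ; from-cong = λ { _≡_.refl → _≡_.refl }
      ; inverse = (λ {x} {y} eq → lemˡ x y eq) , (λ {x} {y} eq → lemʳ x y eq)
      }
  ; preserve = λ u v p → preserve σ _ _ (preserve τ u v p)
  ; reflect  = λ u v p → reflect τ u v (reflect σ _ _ p)
  }
  where
  open import Relation.Binary.PropositionalEquality using (refl; cong)
  lemˡ : ∀ x y → y ≡ Inverse.from (bij τ) (Inverse.from (bij σ) x) → app σ (app τ y) ≡ x
  lemˡ x y refl with Inverse.strictlyInverseˡ (bij τ) (Inverse.from (bij σ) x)
  ... | e rewrite e = Inverse.strictlyInverseˡ (bij σ) x
  lemʳ : ∀ x y → y ≡ app σ (app τ x) → Inverse.from (bij τ) (Inverse.from (bij σ) y) ≡ x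
  lemʳ x y refl rewrite Inverse.strictlyInverseʳ (bij σ) (app τ x) = Inverse.strictlyInverseʳ (bij τ) x

record AutGroupIso (G H : Graph) : Set where
  field
    φ         : Aut G → Aut H
    φ-cong    : ∀ σ τ → σ ≈A τ → φ σ ≈A φ τ
    φ-hom     : ∀ σ τ → φ (σ ∘A τ) ≈A (φ σ ∘A φ τ)
    φ-inj     : ∀ σ τ → φ σ ≈A φ τ → σ ≈A τ
    φ-surj    : ∀ ψ → Σ (Aut G) (λ σ → φ σ ≈A ψ)

data Walk {n : ℕ} (G : SimpleGraph n) : Fin n → Fin n → Set where
  here : ∀ u → Walk G u u
  step : ∀ u v w → adj G u v ≡ true → Walk G v w → Walk G u w

Connected : ∀ {n} → SimpleGraph n → Set
Connected {n} G = ∀ (u v : Fin n) → Walk G u v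

-- The cycle C_n on Fin n (i ~ i+1 mod n); for n ≥ 3 this is the cycle.

cycle : ℕ → Graph
cycle n = record
  { V = Fin n
  ; _~_ = λ i j → (suc (toℕ i) ≡ toℕ j) ⊎ (suc (toℕ j) ≡ toℕ i)
                  ⊎ (toℕ i ≡ 0 × suc (toℕ j) ≡ n) ⊎ (toℕ j ≡ 0 × suc (toℕ i) ≡ n)
  }

-- Edges of G: pairs (i , j) with i < j and i ~ j (canonical representative
-- of the unordered pair {i , j}).

Edge : ∀ {n} → SimpleGraph n → Set
Edge {n} G = Σ (Fin n × Fin n) (λ p → (proj₁ p < proj₂ p) × (adj G (proj₁ p) (proj₂ p) ≡ true))

_∈E_ : ∀ {n} {G : SimpleGraph n} → Fin n → Edge G → Set
v ∈E e = (v ≡ proj₁ (proj₁ e)) ⊎ (v ≡ proj₂ (proj₁ e))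

ShareEnd : ∀ {n} (G : SimpleGraph n) → Edge G → Edge G → Set
ShareEnd {n} G e f = (¬ (e ≡ f)) × Σ (Fin n) (λ v → (_∈E_ {G = G} v e) × (_∈E_ {G = G} v f))

lineGraph : ∀ {n} → SimpleGraph n → Graph
lineGraph G = record { V = Edge G ; _~_ = ShareEnd G }

-- Subdivision graph S(G): vertices V(G) ⊎ E(G) (inj₂ e is w_{u,v})
subAdj : ∀ {n} (G : SimpleGraph n) → Fin n ⊎ Edge G → Fin n ⊎ Edge G → Set
subAdj G (inj₁ u) (inj₁ v) = ⊥
subAdj G (inj₁ u) (inj₂ e) = _∈E_ {G = G} u e
subAdj G (inj₂ e) (inj₁ u) = _∈E_ {G = G} u e
subAdj G (inj₂ e) (inj₂ f) = ⊥

subdivisionGraph : ∀ {n} → SimpleGraph n → Graph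
subdivisionGraph {n} G = record { V = Fin n ⊎ Edge G ; _~_ = subAdj G }

centAdj : ∀ {n} (G : SimpleGraph n) → Fin n ⊎ Edge G → Fin n ⊎ Edge G → Set
centAdj G (inj₁ u) (inj₁ v) = (¬ (u ≡ v)) × (adj G u v ≡ false)
centAdj G (inj₁ u) (inj₂ e) = _∈E_ {G = G} u e
centAdj G (inj₂ e) (inj₁ u) = _∈E_ {G = G} u e
centAdj G (inj₂ e) (inj₂ f) = ⊥

centralGraph : ∀ {n} → SimpleGraph n → Graph
centralGraph {n} G = record { V = Fin n ⊎ Edge G ; _~_ = centAdj G }

midAdj : ∀ {n} (G : SimpleGraph n) → Fin n ⊎ Edge G → Fin n ⊎ Edge G → Set
midAdj G (inj₁ u) (inj₁ v) = ⊥
midAdj G (inj₁ u) (inj₂ e) = _∈E_ {G = G} u e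
midAdj G (inj₂ e) (inj₁ u) = _∈E_ {G = G} u e
midAdj G (inj₂ e) (inj₂ f) = ShareEnd G e f

middleGraph : ∀ {n} → SimpleGraph n → Graph
middleGraph {n} G = record { V = Fin n ⊎ Edge G ; _~_ = midAdj G }

{-# OPTIONS --safe #-}
-- Every automorphism σ of G acts on the edges of G, and with them on L(G), S(G), C(G) and
-- M(G). This gives homomorphisms from Aut(G), injective because (G being connected with
-- n ≥ 3) a vertex is determined by the edges at it; the point is surjectivity.
--
-- For S(G), C(G) and M(G) it suffices that every automorphism ψ maps vertices of G to
-- vertices of G, since ψ then restricts to an automorphism of G inducing ψ. In M(G) the
-- neighbourhood of a vertex is a clique while that of an edge e contains both ends of e,
-- which are not adjacent. In C(G) a vertex has n − 1 ≥ 3 neighbours, an edge only two. In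
-- S(G), if ψ sent a vertex to an edge then, by connectivity, it would send every vertex to
-- an edge; every vertex of G would then have exactly two neighbours, and a connected
-- 2-regular graph is a cycle.
--
-- For L(G) this is Whitney's argument. Three pairwise meeting edges form a star or a
-- triangle of G, and only a star has an edge meeting an odd number of its edges (for a
-- star this uses connectivity and n ≥ 5). So automorphisms of L(G) map stars of three edges
-- to stars, which sends the edges at a vertex v onto the edges at a vertex w; v ↦ w is the
-- automorphism of G inducing ψ (a vertex of degree one is placed through its neighbour).
module Submission where

open import Defs renaming (sym to adj-sym)
open import Data.Nat as ℕ using (ℕ; zero; suc; z≤n; s≤s; _≤_; _<_)
import Data.Nat.Properties as ℕ
open import Data.Fin as Fin using (Fin; toℕ; fromℕ<)
import Data.Fin.Properties as Fin
open import Data.Bool using (Bool; true; false)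
import Data.Bool.Properties as Bool
open import Data.Product using (Σ; ∃; _×_; _,_; proj₁; proj₂)
open import Data.Sum using (_⊎_; inj₁; inj₂)
open import Data.Sum.Properties using (inj₁-injective)
open import Data.Empty using (⊥; ⊥-elim)
open import Relation.Nullary using (¬_; Dec; yes; no; contradiction; ¬?)
open import Relation.Nullary.Decidable using (_×-dec_)
open import Relation.Binary.Definitions using (tri<; tri≈; tri>)
open import Relation.Binary.PropositionalEquality
  using (_≡_; _≢_; refl; sym; trans; cong; subst; subst₂; ≢-sym; module ≡-Reasoning)
open import Axiom.UniquenessOfIdentityProofs using (module Decidable⇒UIP)
open import Function.Base using (id; _∘_)
open import Function.Bundles using (Inverse; mk↔ₛ′; _⇔_; mk⇔; Equivalence)
import Function.Properties.Equivalence as ⇔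
open import Data.List as List using (List; []; _∷_; length)
open import Data.List.Membership.Propositional using (_∈_; _∉_)
open import Data.List.Relation.Unary.Any using (here; there; index)
open import Data.List.Relation.Unary.Any.Properties using (lookup-index)

graphIso : ∀ {G H : Graph} (f : V G → V H) (g : V H → V G)
  → (∀ y → f (g y) ≡ y) → (∀ x → g (f x) ≡ x)
  → (∀ u v → _~_ G u v → _~_ H (f u) (f v))
  → (∀ u v → _~_ H (f u) (f v) → _~_ G u v)
  → GraphIso G H
graphIso f g fg gf preserves reflects =
  record { bij = mk↔ₛ′ f g fg gf ; preserve = preserves ; reflect = reflects }

module _ {X : Graph} where

  app⁻¹ : Aut X → V X → V X
  app⁻¹ σ = Inverse.from (bij σ)

  app-app⁻¹ : ∀ (σ : Aut X) y → app σ (app⁻¹ σ y) ≡ y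
  app-app⁻¹ σ = Inverse.strictlyInverseˡ (bij σ)

  app⁻¹-app : ∀ (σ : Aut X) x → app⁻¹ σ (app σ x) ≡ x
  app⁻¹-app σ = Inverse.strictlyInverseʳ (bij σ)

  app-injective : ∀ (σ : Aut X) {x y} → app σ x ≡ app σ y → x ≡ y
  app-injective σ {x} {y} eq =
    trans (sym (app⁻¹-app σ x)) (trans (cong (app⁻¹ σ) eq) (app⁻¹-app σ y))

  invAut : Aut X → Aut X
  invAut σ = graphIso (app⁻¹ σ) (app σ) (app⁻¹-app σ) (app-app⁻¹ σ)
    (λ u v u~v → reflect σ _ _ (subst₂ (_~_ X) (sym (app-app⁻¹ σ u)) (sym (app-app⁻¹ σ v)) u~v))
    (λ u v p → subst₂ (_~_ X) (app-app⁻¹ σ u) (app-app⁻¹ σ v) (preserve σ _ _ p))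

  reflect⁻¹ : ∀ (σ : Aut X) {x y} → _~_ X (app σ x) y → _~_ X x (app⁻¹ σ y)
  reflect⁻¹ σ {x} {y} p = reflect σ _ _ (subst (_~_ X (app σ x)) (sym (app-app⁻¹ σ y)) p)

Invariant : (X : Graph) → (V X → Set) → Set
Invariant X P = ∀ (σ : Aut X) x → P x → P (app σ x)

module _ (X : Graph) where
  open Graph X using () renaming (_~_ to _∼_)

  NeighbourhoodIsClique : V X → Set
  NeighbourhoodIsClique x = ∀ y z → x ∼ y → x ∼ z → y ≢ z → y ∼ z

  HasThreeNeighbours : V X → Set
  HasThreeNeighbours x = Σ (V X) λ y → Σ (V X) λ z → Σ (V X) λ w →
    (x ∼ y × x ∼ z × x ∼ w) × (y ≢ z × y ≢ w × z ≢ w)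

  HasExactlyTwoNeighbours : V X → Set
  HasExactlyTwoNeighbours x = Σ (V X) λ y → Σ (V X) λ z →
    y ≢ z × x ∼ y × x ∼ z × (∀ w → x ∼ w → w ≡ y ⊎ w ≡ z)

  neighbourhoodIsClique-invariant : Invariant X NeighbourhoodIsClique
  neighbourhoodIsClique-invariant σ x clique y z σx∼y σx∼z y≢z =
    subst₂ _∼_ (app-app⁻¹ σ y) (app-app⁻¹ σ z)
      (preserve σ _ _ (clique _ _ (reflect⁻¹ σ σx∼y) (reflect⁻¹ σ σx∼z)
                                  (λ eq → y≢z (app-injective (invAut σ) eq))))

  hasThreeNeighbours-invariant : Invariant X HasThreeNeighbours
  hasThreeNeighbours-invariant σ x (y , z , w , (x∼y , x∼z , x∼w) , (y≢z , y≢w , z≢w)) =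
    app σ y , app σ z , app σ w ,
    (preserve σ _ _ x∼y , preserve σ _ _ x∼z , preserve σ _ _ x∼w) ,
    (λ eq → y≢z (app-injective σ eq)) , (λ eq → y≢w (app-injective σ eq)) ,
    (λ eq → z≢w (app-injective σ eq))

  hasExactlyTwoNeighbours-invariant : Invariant X HasExactlyTwoNeighbours
  hasExactlyTwoNeighbours-invariant σ x (y , z , y≢z , x∼y , x∼z , only) =
    app σ y , app σ z , (λ eq → y≢z (app-injective σ eq)) ,
    preserve σ _ _ x∼y , preserve σ _ _ x∼z , only′
    where
    only′ : ∀ w → app σ x ∼ w → w ≡ app σ y ⊎ w ≡ app σ z
    only′ w σx∼w with only (app⁻¹ σ w) (reflect⁻¹ σ σx∼w)
    ... | inj₁ eq = inj₁ (trans (sym (app-app⁻¹ σ w)) (cong (app σ) eq))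
    ... | inj₂ eq = inj₂ (trans (sym (app-app⁻¹ σ w)) (cong (app σ) eq))

module Edges {n : ℕ} (G : SimpleGraph n) where

  E : Set
  E = Edge G

  Adj : Fin n → Fin n → Set
  Adj u v = adj G u v ≡ true

  infix 4 _∈e_
  _∈e_ : Fin n → E → Set
  v ∈e e = _∈E_ {G = G} v e

  Meets : E → E → Set
  Meets = ShareEnd G

  lo hi : E → Fin n
  lo e = proj₁ (proj₁ e)
  hi e = proj₂ (proj₁ e)

  lo∈ : ∀ e → lo e ∈e e
  lo∈ e = inj₁ refl

  hi∈ : ∀ e → hi e ∈e e
  hi∈ e = inj₂ refl

  lo<hi : ∀ e → lo e Fin.< hi e
  lo<hi e = proj₁ (proj₂ e)

  lo≢hi : ∀ e → lo e ≢ hi e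
  lo≢hi e eq = Fin.<-irrefl eq (lo<hi e)

  Adj-lo-hi : ∀ e → Adj (lo e) (hi e)
  Adj-lo-hi e = proj₂ (proj₂ e)

  Adj-irrefl : ∀ {u v} → Adj u v → u ≢ v
  Adj-irrefl {u} u~u refl with trans (sym u~u) (irrefl G u)
  ... | ()

  Adj-sym : ∀ {u v} → Adj u v → Adj v u
  Adj-sym {u} {v} u~v = trans (adj-sym G v u) u~v

  edge-≡ : ∀ (e f : E) → lo e ≡ lo f → hi e ≡ hi f → e ≡ f
  edge-≡ ((u , v) , u<v , u~v) ((.u , .v) , u<v′ , u~v′) refl refl
    with Fin.<-irrelevant u<v u<v′ | Decidable⇒UIP.≡-irrelevant Bool._≟_ u~v u~v′
  ... | refl | refl = refl

  endpoints : ∀ {u v} e → u ≢ v → u ∈e e → v ∈e e →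
              (u ≡ lo e × v ≡ hi e) ⊎ (u ≡ hi e × v ≡ lo e)
  endpoints e u≢v (inj₁ u≡) (inj₁ v≡) = ⊥-elim (u≢v (trans u≡ (sym v≡)))
  endpoints e u≢v (inj₁ u≡) (inj₂ v≡) = inj₁ (u≡ , v≡)
  endpoints e u≢v (inj₂ u≡) (inj₁ v≡) = inj₂ (u≡ , v≡)
  endpoints e u≢v (inj₂ u≡) (inj₂ v≡) = ⊥-elim (u≢v (trans u≡ (sym v≡)))

  ∈e-two : ∀ {x z w} e → x ≢ z → x ∈e e → z ∈e e → w ∈e e → w ≡ x ⊎ w ≡ z
  ∈e-two e x≢z x∈ z∈ w∈ with endpoints e x≢z x∈ z∈ | w∈
  ... | inj₁ (x≡ , _) | inj₁ w≡ = inj₁ (trans w≡ (sym x≡))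
  ... | inj₁ (_ , z≡) | inj₂ w≡ = inj₂ (trans w≡ (sym z≡))
  ... | inj₂ (_ , z≡) | inj₁ w≡ = inj₂ (trans w≡ (sym z≡))
  ... | inj₂ (x≡ , _) | inj₂ w≡ = inj₁ (trans w≡ (sym x≡))

  edge-unique : ∀ {u v e f} → u ≢ v → u ∈e e → v ∈e e → u ∈e f → v ∈e f → e ≡ f
  edge-unique {e = e} {f} u≢v u∈e v∈e u∈f v∈f
    with endpoints e u≢v u∈e v∈e | endpoints f u≢v u∈f v∈f
  ... | inj₁ (a , b) | inj₁ (c , d) = edge-≡ e f (trans (sym a) c) (trans (sym b) d)
  ... | inj₂ (a , b) | inj₂ (c , d) = edge-≡ e f (trans (sym b) d) (trans (sym a) c)
  ... | inj₁ (a , b) | inj₂ (c , d) =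
    ⊥-elim (Fin.<-asym (subst₂ Fin._<_ (sym a) (sym b) (lo<hi e)) (subst₂ Fin._<_ (sym d) (sym c) (lo<hi f)))
  ... | inj₂ (a , b) | inj₁ (c , d) =
    ⊥-elim (Fin.<-asym (subst₂ Fin._<_ (sym b) (sym a) (lo<hi e)) (subst₂ Fin._<_ (sym c) (sym d) (lo<hi f)))

  common-unique : ∀ {e f x y} → e ≢ f → x ∈e e → x ∈e f → y ∈e e → y ∈e f → x ≡ y
  common-unique {x = x} {y} e≢f x∈e x∈f y∈e y∈f with x Fin.≟ y
  ... | yes x≡y = x≡y
  ... | no x≢y = ⊥-elim (e≢f (edge-unique x≢y x∈e y∈e x∈f y∈f))

  ∈e-Adj : ∀ {u v} e → u ∈e e → v ∈e e → u ≢ v → Adj u v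
  ∈e-Adj e u∈ v∈ u≢v with endpoints e u≢v u∈ v∈
  ... | inj₁ (refl , refl) = Adj-lo-hi e
  ... | inj₂ (refl , refl) = Adj-sym (Adj-lo-hi e)

  ∈e-pigeonhole : ∀ {a b c} e → a ∈e e → b ∈e e → c ∈e e → a ≡ b ⊎ a ≡ c ⊎ b ≡ c
  ∈e-pigeonhole e (inj₁ a≡) (inj₁ b≡) _ = inj₁ (trans a≡ (sym b≡))
  ∈e-pigeonhole e (inj₂ a≡) (inj₂ b≡) _ = inj₁ (trans a≡ (sym b≡))
  ∈e-pigeonhole e (inj₁ a≡) (inj₂ _) (inj₁ c≡) = inj₂ (inj₁ (trans a≡ (sym c≡)))
  ∈e-pigeonhole e (inj₁ _) (inj₂ b≡) (inj₂ c≡) = inj₂ (inj₂ (trans b≡ (sym c≡)))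
  ∈e-pigeonhole e (inj₂ _) (inj₁ b≡) (inj₁ c≡) = inj₂ (inj₂ (trans b≡ (sym c≡)))
  ∈e-pigeonhole e (inj₂ a≡) (inj₁ _) (inj₂ c≡) = inj₂ (inj₁ (trans a≡ (sym c≡)))

  _∈e?_ : ∀ x e → Dec (x ∈e e)
  x ∈e? e with x Fin.≟ lo e | x Fin.≟ hi e
  ... | yes x≡lo | _ = yes (inj₁ x≡lo)
  ... | no _ | yes x≡hi = yes (inj₂ x≡hi)
  ... | no x≢lo | no x≢hi = no λ { (inj₁ x≡lo) → x≢lo x≡lo ; (inj₂ x≡hi) → x≢hi x≡hi }

  _≟e_ : ∀ (e f : E) → Dec (e ≡ f)
  e ≟e f with lo e Fin.≟ lo f | hi e Fin.≟ hi f
  ... | yes lo≡ | yes hi≡ = yes (edge-≡ e f lo≡ hi≡)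
  ... | no lo≢ | _ = no λ e≡f → lo≢ (cong lo e≡f)
  ... | yes _ | no hi≢ = no λ e≡f → hi≢ (cong hi e≡f)

  Meets-sym : ∀ {e f} → Meets e f → Meets f e
  Meets-sym (e≢f , v , v∈e , v∈f) = (λ f≡e → e≢f (sym f≡e)) , v , v∈f , v∈e

  meets : ∀ {e f v} → e ≢ f → v ∈e e → v ∈e f → Meets e f
  meets e≢f v∈e v∈f = e≢f , _ , v∈e , v∈f

  edge : ∀ u v → Adj u v → E
  edge u v u~v with Fin.<-cmp u v
  ... | tri< u<v _ _ = (u , v) , u<v , u~v
  ... | tri≈ _ u≡v _ = ⊥-elim (Adj-irrefl u~v u≡v)
  ... | tri> _ _ v<u = (v , u) , v<u , Adj-sym u~v

  ∈edgeˡ : ∀ u v (u~v : Adj u v) → u ∈e edge u v u~v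
  ∈edgeˡ u v u~v with Fin.<-cmp u v
  ... | tri< _ _ _ = inj₁ refl
  ... | tri≈ _ u≡v _ = ⊥-elim (Adj-irrefl u~v u≡v)
  ... | tri> _ _ _ = inj₂ refl

  ∈edgeʳ : ∀ u v (u~v : Adj u v) → v ∈e edge u v u~v
  ∈edgeʳ u v u~v with Fin.<-cmp u v
  ... | tri< _ _ _ = inj₂ refl
  ... | tri≈ _ u≡v _ = ⊥-elim (Adj-irrefl u~v u≡v)
  ... | tri> _ _ _ = inj₁ refl

  ∈edge⁻ : ∀ u v (u~v : Adj u v) {w} → w ∈e edge u v u~v → w ≡ u ⊎ w ≡ v
  ∈edge⁻ u v u~v = ∈e-two (edge u v u~v) (Adj-irrefl u~v) (∈edgeˡ u v u~v) (∈edgeʳ u v u~v)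

  other : E → Fin n → Fin n
  other e v with v Fin.≟ lo e
  ... | yes _ = hi e
  ... | no _ = lo e

  other∈ : ∀ e v → other e v ∈e e
  other∈ e v with v Fin.≟ lo e
  ... | yes _ = hi∈ e
  ... | no _ = lo∈ e

  other≢ : ∀ e {v} → v ∈e e → other e v ≢ v
  other≢ e {v} v∈ with v Fin.≟ lo e
  ... | yes v≡lo = λ hi≡v → lo≢hi e (trans (sym v≡lo) (sym hi≡v))
  other≢ e (inj₁ v≡lo) | no v≢lo = λ _ → v≢lo v≡lo
  other≢ e (inj₂ v≡hi) | no _ = λ lo≡v → lo≢hi e (trans lo≡v v≡hi)

  ∈e-other : ∀ e {v w} → v ∈e e → w ∈e e → w ≡ v ⊎ w ≡ other e v
  ∈e-other e {v} v∈ w∈ = ∈e-two e (λ v≡ → other≢ e v∈ (sym v≡)) v∈ (other∈ e v) w∈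

  Adj-other : ∀ e {v} → v ∈e e → Adj v (other e v)
  Adj-other e {v} v∈ = ∈e-Adj e v∈ (other∈ e v) (λ v≡ → other≢ e v∈ (sym v≡))

module _ {n : ℕ} where
  open import Data.List.Membership.DecPropositional (Fin._≟_ {n}) using (_∈?_)

  fresh : (xs : List (Fin n)) → length xs < n → ∃ λ x → x ∉ xs
  fresh xs |xs|<n with Fin.all? (_∈? xs)
  ... | yes all∈ = ⊥-elim (ℕ.<⇒≱ |xs|<n (Fin.injective⇒≤ index-injective))
    where
    index-injective : ∀ {x y} → index (all∈ x) ≡ index (all∈ y) → x ≡ y
    index-injective {x} {y} eq =
      trans (lookup-index (all∈ x)) (trans (cong (List.lookup xs) eq) (sym (lookup-index (all∈ y))))
  ... | no ¬all∈ = Fin.¬∀⟶∃¬ n (_∈ xs) (_∈? xs) ¬all∈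

  threeOthers : 4 ≤ n → (u : Fin n) → Σ (Fin n) λ x₁ → Σ (Fin n) λ x₂ → Σ (Fin n) λ x₃ →
                (x₁ ≢ u × x₂ ≢ u × x₃ ≢ u) × (x₁ ≢ x₂ × x₁ ≢ x₃ × x₂ ≢ x₃)
  threeOthers 4≤n u with fresh (u ∷ []) (ℕ.≤-trans (s≤s (s≤s z≤n)) 4≤n)
  ... | x₁ , x₁∉ with fresh (u ∷ x₁ ∷ []) (ℕ.≤-trans (s≤s (s≤s (s≤s z≤n))) 4≤n)
  ... | x₂ , x₂∉ with fresh (u ∷ x₁ ∷ x₂ ∷ []) 4≤n
  ... | x₃ , x₃∉ =
    x₁ , x₂ , x₃ , (x₁∉ ∘ here , x₂∉ ∘ here , x₃∉ ∘ here) ,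
    (x₂∉ ∘ there ∘ here ∘ sym , x₃∉ ∘ there ∘ here ∘ sym , x₃∉ ∘ there ∘ there ∘ here ∘ sym)

module Walks {n : ℕ} (G : SimpleGraph n) where
  open Edges G
  open import Data.List.Membership.DecPropositional (Fin._≟_ {n}) using (_∈?_)

  walk-transport : (P : Fin n → Set) → (∀ {u v} → Adj u v → P u → P v) →
                   ∀ {u v} → Walk G u v → P u → P v
  walk-transport P step-P (here u) Pu = Pu
  walk-transport P step-P (step u v w u~v walk) Pu = walk-transport P step-P walk (step-P u~v Pu)

  walk-exit : (P : Fin n → Set) → (∀ y → Dec (P y)) → ∀ {u v} → Walk G u v → P u → ¬ P v →
              Σ (Fin n) λ y → Σ (Fin n) λ z → P y × ¬ P z × Adj y z
  walk-exit P P? (here u) Pu ¬Pu = ⊥-elim (¬Pu Pu)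
  walk-exit P P? (step u v w u~v walk) Pu ¬Pw with P? v
  ... | yes Pv = walk-exit P P? walk Pv ¬Pw
  ... | no ¬Pv = u , v , Pu , ¬Pv , u~v

  edgeLeaving : Connected G → (xs : List (Fin n)) → length xs < n → ∀ {u} → u ∈ xs →
                Σ (Fin n) λ y → Σ (Fin n) λ z → y ∈ xs × z ∉ xs × Adj y z
  edgeLeaving connected xs |xs|<n {u} u∈ with fresh xs |xs|<n
  ... | x , x∉ = walk-exit (_∈ xs) (_∈? xs) (connected u x) u∈ x∉

-- Automorphisms of G acting on edges

module Induced {n : ℕ} (G : SimpleGraph n) where
  open Edges G

  edgeMap : Aut ⟦ G ⟧ → E → E
  edgeMap σ e = edge (app σ (lo e)) (app σ (hi e)) (preserve σ _ _ (Adj-lo-hi e))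

  ∈edgeMap : ∀ (σ : Aut ⟦ G ⟧) {v} e → v ∈e e → app σ v ∈e edgeMap σ e
  ∈edgeMap σ e (inj₁ refl) = ∈edgeˡ _ _ (preserve σ _ _ (Adj-lo-hi e))
  ∈edgeMap σ e (inj₂ refl) = ∈edgeʳ _ _ (preserve σ _ _ (Adj-lo-hi e))

  ∈edgeMap⁻ : ∀ (σ : Aut ⟦ G ⟧) {w} e → w ∈e edgeMap σ e → app⁻¹ σ w ∈e e
  ∈edgeMap⁻ σ e w∈ with ∈edge⁻ _ _ (preserve σ _ _ (Adj-lo-hi e)) w∈
  ... | inj₁ refl = inj₁ (app⁻¹-app σ (lo e))
  ... | inj₂ refl = inj₂ (app⁻¹-app σ (hi e))

  app∈edgeMap⁻ : ∀ (σ : Aut ⟦ G ⟧) {v} e → app σ v ∈e edgeMap σ e → v ∈e e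
  app∈edgeMap⁻ σ {v} e σv∈ = subst (_∈e e) (app⁻¹-app σ v) (∈edgeMap⁻ σ e σv∈)

  edgeMap-unique : ∀ (σ : Aut ⟦ G ⟧) e {f} → app σ (lo e) ∈e f → app σ (hi e) ∈e f → edgeMap σ e ≡ f
  edgeMap-unique σ e lo∈f hi∈f =
    edge-unique (λ eq → lo≢hi e (app-injective σ eq))
      (∈edgeMap σ e (lo∈ e)) (∈edgeMap σ e (hi∈ e)) lo∈f hi∈f

  edgeMap-inverseʳ : ∀ (σ : Aut ⟦ G ⟧) e → edgeMap (invAut σ) (edgeMap σ e) ≡ e
  edgeMap-inverseʳ σ e =
    edgeMap-unique (invAut σ) (edgeMap σ e)
      (∈edgeMap⁻ σ e (lo∈ (edgeMap σ e))) (∈edgeMap⁻ σ e (hi∈ (edgeMap σ e)))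

  edgeMap-inverseˡ : ∀ (σ : Aut ⟦ G ⟧) e → edgeMap σ (edgeMap (invAut σ) e) ≡ e
  edgeMap-inverseˡ σ e =
    edgeMap-unique σ (edgeMap (invAut σ) e)
      (∈edgeMap⁻ (invAut σ) e (lo∈ (edgeMap (invAut σ) e)))
      (∈edgeMap⁻ (invAut σ) e (hi∈ (edgeMap (invAut σ) e)))

  edgeMap-injective : ∀ (σ : Aut ⟦ G ⟧) {e f} → edgeMap σ e ≡ edgeMap σ f → e ≡ f
  edgeMap-injective σ {e} {f} eq =
    trans (sym (edgeMap-inverseʳ σ e)) (trans (cong (edgeMap (invAut σ)) eq) (edgeMap-inverseʳ σ f))

  edgeMap-cong : ∀ (σ τ : Aut ⟦ G ⟧) → _≈A_ {⟦ G ⟧} σ τ → ∀ e → edgeMap σ e ≡ edgeMap τ e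
  edgeMap-cong σ τ σ≈τ e = edgeMap-unique σ e
    (subst (_∈e edgeMap τ e) (sym (σ≈τ (lo e))) (∈edgeMap τ e (lo∈ e)))
    (subst (_∈e edgeMap τ e) (sym (σ≈τ (hi e))) (∈edgeMap τ e (hi∈ e)))

  edgeMap-∘ : ∀ (σ τ : Aut ⟦ G ⟧) e → edgeMap (_∘A_ {⟦ G ⟧} σ τ) e ≡ edgeMap σ (edgeMap τ e)
  edgeMap-∘ σ τ e = edgeMap-unique (_∘A_ {⟦ G ⟧} σ τ) e
    (∈edgeMap σ (edgeMap τ e) (∈edgeMap τ e (lo∈ e)))
    (∈edgeMap σ (edgeMap τ e) (∈edgeMap τ e (hi∈ e)))

  edgeMap-Meets : ∀ (σ : Aut ⟦ G ⟧) {e f} → Meets e f → Meets (edgeMap σ e) (edgeMap σ f)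
  edgeMap-Meets σ {e} {f} (e≢f , v , v∈e , v∈f) =
    (λ eq → e≢f (edgeMap-injective σ eq)) , app σ v , ∈edgeMap σ e v∈e , ∈edgeMap σ f v∈f

  edgeMap-Meets⁻ : ∀ (σ : Aut ⟦ G ⟧) {e f} → Meets (edgeMap σ e) (edgeMap σ f) → Meets e f
  edgeMap-Meets⁻ σ {e} {f} (σe≢σf , w , w∈σe , w∈σf) =
    (λ e≡f → σe≢σf (cong (edgeMap σ) e≡f)) , app⁻¹ σ w , ∈edgeMap⁻ σ e w∈σe , ∈edgeMap⁻ σ f w∈σf

  lineAut : Aut ⟦ G ⟧ → Aut (lineGraph G)
  lineAut σ = graphIso (edgeMap σ) (edgeMap (invAut σ)) (edgeMap-inverseˡ σ) (edgeMap-inverseʳ σ)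
    (λ _ _ → edgeMap-Meets σ) (λ _ _ → edgeMap-Meets⁻ σ)

  incidence-preserves-Adj : (f g : Fin n → Fin n) → (∀ v → g (f v) ≡ v) →
                            (ε : E → E) → (∀ {v e} → v ∈e e → f v ∈e ε e) →
                            ∀ {u v} → Adj u v → Adj (f u) (f v)
  incidence-preserves-Adj f g gf ε ε-incident {u} {v} u~v =
    ∈e-Adj (ε (edge u v u~v)) (ε-incident (∈edgeˡ u v u~v)) (ε-incident (∈edgeʳ u v u~v))
      (λ fu≡fv → Adj-irrefl u~v (trans (sym (gf u)) (trans (cong g fu≡fv) (gf v))))

  module FromIncidence (f g : Fin n → Fin n) (fg : ∀ v → f (g v) ≡ v) (gf : ∀ v → g (f v) ≡ v)
           (ε δ : E → E) (ε-incident : ∀ {v e} → v ∈e e → f v ∈e ε e)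
           (δ-incident : ∀ {v e} → v ∈e e → g v ∈e δ e) where

    incidenceAut : Aut ⟦ G ⟧
    incidenceAut = graphIso f g fg gf
      (λ _ _ → incidence-preserves-Adj f g gf ε ε-incident)
      (λ u v fu~fv → subst₂ Adj (gf u) (gf v) (incidence-preserves-Adj g f fg δ δ-incident fu~fv))

    edgeMap-incidenceAut : ∀ e → edgeMap incidenceAut e ≡ ε e
    edgeMap-incidenceAut e = edgeMap-unique incidenceAut e (ε-incident (lo∈ e)) (ε-incident (hi∈ e))

-- Graphs on the vertices and edges of G

module VertexEdgeGraphs {n : ℕ} (G : SimpleGraph n) where
  open Edges G
  open Induced G

  W : Set
  W = Fin n ⊎ E

  extend : Aut ⟦ G ⟧ → W → W
  extend σ (inj₁ v) = inj₁ (app σ v)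
  extend σ (inj₂ e) = inj₂ (edgeMap σ e)

  extend-inverseˡ : ∀ (σ : Aut ⟦ G ⟧) x → extend σ (extend (invAut σ) x) ≡ x
  extend-inverseˡ σ (inj₁ v) = cong inj₁ (app-app⁻¹ σ v)
  extend-inverseˡ σ (inj₂ e) = cong inj₂ (edgeMap-inverseˡ σ e)

  extend-inverseʳ : ∀ (σ : Aut ⟦ G ⟧) x → extend (invAut σ) (extend σ x) ≡ x
  extend-inverseʳ σ (inj₁ v) = cong inj₁ (app⁻¹-app σ v)
  extend-inverseʳ σ (inj₂ e) = cong inj₂ (edgeMap-inverseʳ σ e)

  extend-cong : ∀ (σ τ : Aut ⟦ G ⟧) → _≈A_ {⟦ G ⟧} σ τ → ∀ x → extend σ x ≡ extend τ x
  extend-cong σ τ σ≈τ (inj₁ v) = cong inj₁ (σ≈τ v)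
  extend-cong σ τ σ≈τ (inj₂ e) = cong inj₂ (edgeMap-cong σ τ σ≈τ e)

  extend-∘ : ∀ (σ τ : Aut ⟦ G ⟧) x → extend (_∘A_ {⟦ G ⟧} σ τ) x ≡ extend σ (extend τ x)
  extend-∘ σ τ (inj₁ v) = refl
  extend-∘ σ τ (inj₂ e) = cong inj₂ (edgeMap-∘ σ τ e)

  module _ (R : W → W → Set)
           (incident : ∀ {v e} → R (inj₁ v) (inj₂ e) → v ∈e e)
           (incident⁻ : ∀ {v e} → v ∈e e → R (inj₁ v) (inj₂ e))
           (extend-preserves : ∀ σ x y → R x y → R (extend σ x) (extend σ y))
           (extend-reflects : ∀ σ x y → R (extend σ x) (extend σ y) → R x y) where

    X : Graph
    X = record { V = W ; _~_ = R }

    extendAut : Aut ⟦ G ⟧ → Aut X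
    extendAut σ = graphIso (extend σ) (extend (invAut σ)) (extend-inverseˡ σ) (extend-inverseʳ σ)
      (extend-preserves σ) (extend-reflects σ)

    VertexPreserving : Aut X → Set
    VertexPreserving ψ = ∀ v e → app ψ (inj₁ v) ≢ inj₂ e

    module Lift (vertexPreserving : ∀ ψ → VertexPreserving ψ) (ψ : Aut X) where

      vertexImage : ∀ v → Σ (Fin n) λ w → app ψ (inj₁ v) ≡ inj₁ w
      vertexImage v with app ψ (inj₁ v) in eq
      ... | inj₁ w = w , refl
      ... | inj₂ e = ⊥-elim (vertexPreserving ψ v e eq)

      edgeImage : ∀ e → Σ E λ f → app ψ (inj₂ e) ≡ inj₂ f
      edgeImage e with app ψ (inj₂ e) in eq
      ... | inj₂ f = f , refl
      ... | inj₁ w = ⊥-elim (vertexPreserving (invAut ψ) w e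
                               (trans (cong (app⁻¹ ψ) (sym eq)) (app⁻¹-app ψ (inj₂ e))))

      onVertices : Fin n → Fin n
      onVertices v = proj₁ (vertexImage v)

      onEdges : E → E
      onEdges e = proj₁ (edgeImage e)

      onVertices-incident : ∀ {v e} → v ∈e e → onVertices v ∈e onEdges e
      onVertices-incident {v} {e} v∈e =
        incident (subst₂ R (proj₂ (vertexImage v)) (proj₂ (edgeImage e)) (preserve ψ _ _ (incident⁻ v∈e)))

    liftAut : (∀ ψ → VertexPreserving ψ) → ∀ ψ → Σ (Aut ⟦ G ⟧) λ σ → ∀ x → extend σ x ≡ app ψ x
    liftAut vertexPreserving ψ = σ , extend-σ
      where
      open Lift vertexPreserving
      open ≡-Reasoning
      vertex-inverseˡ : ∀ v → onVertices ψ (onVertices (invAut ψ) v) ≡ v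
      vertex-inverseˡ v = inj₁-injective (begin
        inj₁ (onVertices ψ (onVertices (invAut ψ) v)) ≡⟨ sym (proj₂ (vertexImage ψ _)) ⟩
        app ψ (inj₁ (onVertices (invAut ψ) v))        ≡⟨ cong (app ψ) (sym (proj₂ (vertexImage (invAut ψ) v))) ⟩
        app ψ (app⁻¹ ψ (inj₁ v))                      ≡⟨ app-app⁻¹ ψ (inj₁ v) ⟩
        inj₁ v                                        ∎)
      vertex-inverseʳ : ∀ v → onVertices (invAut ψ) (onVertices ψ v) ≡ v
      vertex-inverseʳ v = inj₁-injective (begin
        inj₁ (onVertices (invAut ψ) (onVertices ψ v)) ≡⟨ sym (proj₂ (vertexImage (invAut ψ) _)) ⟩
        app⁻¹ ψ (inj₁ (onVertices ψ v))               ≡⟨ cong (app⁻¹ ψ) (sym (proj₂ (vertexImage ψ v))) ⟩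
        app⁻¹ ψ (app ψ (inj₁ v))                      ≡⟨ app⁻¹-app ψ (inj₁ v) ⟩
        inj₁ v                                        ∎)
      open FromIncidence (onVertices ψ) (onVertices (invAut ψ)) vertex-inverseˡ vertex-inverseʳ
             (onEdges ψ) (onEdges (invAut ψ)) (onVertices-incident ψ) (onVertices-incident (invAut ψ))
             renaming (incidenceAut to σ)
      extend-σ : ∀ x → extend σ x ≡ app ψ x
      extend-σ (inj₁ v) = sym (proj₂ (vertexImage ψ v))
      extend-σ (inj₂ e) = trans (cong inj₂ (edgeMap-incidenceAut e)) (sym (proj₂ (edgeImage ψ e)))

    extendIso : (∀ ψ → VertexPreserving ψ) → AutGroupIso ⟦ G ⟧ X
    extendIso vertexPreserving = record
      { φ      = extendAut
      ; φ-cong = extend-cong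
      ; φ-hom  = extend-∘
      ; φ-inj  = λ σ τ eq v → inj₁-injective (eq (inj₁ v))
      ; φ-surj = liftAut vertexPreserving
      }

-- The middle graph

module MiddleGraph {n : ℕ} (G : SimpleGraph n) where
  open Edges G
  open Induced G
  open VertexEdgeGraphs G

  extend-preserves : ∀ σ x y → midAdj G x y → midAdj G (extend σ x) (extend σ y)
  extend-preserves σ (inj₁ u) (inj₂ e) = ∈edgeMap σ e
  extend-preserves σ (inj₂ e) (inj₁ u) = ∈edgeMap σ e
  extend-preserves σ (inj₂ e) (inj₂ f) = edgeMap-Meets σ

  extend-reflects : ∀ σ x y → midAdj G (extend σ x) (extend σ y) → midAdj G x y
  extend-reflects σ (inj₁ u) (inj₂ e) = app∈edgeMap⁻ σ e
  extend-reflects σ (inj₂ e) (inj₁ u) = app∈edgeMap⁻ σ e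
  extend-reflects σ (inj₂ e) (inj₂ f) = edgeMap-Meets⁻ σ

  vertex-neighbourhoodIsClique : ∀ v → NeighbourhoodIsClique (middleGraph G) (inj₁ v)
  vertex-neighbourhoodIsClique v (inj₂ e) (inj₂ f) v∈e v∈f e≢f = meets (λ e≡f → e≢f (cong inj₂ e≡f)) v∈e v∈f

  edge-neighbourhoodNotClique : ∀ e → ¬ NeighbourhoodIsClique (middleGraph G) (inj₂ e)
  edge-neighbourhoodNotClique e clique =
    clique (inj₁ (lo e)) (inj₁ (hi e)) (lo∈ e) (hi∈ e) (λ eq → lo≢hi e (inj₁-injective eq))

  vertexPreserving : ∀ (ψ : Aut (middleGraph G)) v e → app ψ (inj₁ v) ≢ inj₂ e
  vertexPreserving ψ v e ψv≡e = edge-neighbourhoodNotClique e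
    (subst (NeighbourhoodIsClique (middleGraph G)) ψv≡e
      (neighbourhoodIsClique-invariant (middleGraph G) ψ (inj₁ v) (vertex-neighbourhoodIsClique v)))

  autMiddleGraph : AutGroupIso ⟦ G ⟧ (middleGraph G)
  autMiddleGraph = extendIso (midAdj G) id id extend-preserves extend-reflects vertexPreserving

-- The central graph

module CentralGraph {n : ℕ} (G : SimpleGraph n) where
  open Edges G
  open Induced G
  open VertexEdgeGraphs G

  contrapositive-false : ∀ {b c : Bool} → (b ≡ true → c ≡ true) → c ≡ false → b ≡ false
  contrapositive-false b→c c≡false =
    Bool.¬-not λ b≡true → contradiction (trans (sym (b→c b≡true)) c≡false) λ ()

  extend-preserves : ∀ σ x y → centAdj G x y → centAdj G (extend σ x) (extend σ y)
  extend-preserves σ (inj₁ u) (inj₁ v) (u≢v , u≁v) =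
    (λ eq → u≢v (app-injective σ eq)) , contrapositive-false (reflect σ u v) u≁v
  extend-preserves σ (inj₁ u) (inj₂ e) = ∈edgeMap σ e
  extend-preserves σ (inj₂ e) (inj₁ u) = ∈edgeMap σ e

  extend-reflects : ∀ σ x y → centAdj G (extend σ x) (extend σ y) → centAdj G x y
  extend-reflects σ (inj₁ u) (inj₁ v) (σu≢σv , σu≁σv) =
    (λ eq → σu≢σv (cong (app σ) eq)) , contrapositive-false (preserve σ u v) σu≁σv
  extend-reflects σ (inj₁ u) (inj₂ e) = app∈edgeMap⁻ σ e
  extend-reflects σ (inj₂ e) (inj₁ u) = app∈edgeMap⁻ σ e

  Through : Fin n → W → Set
  Through x (inj₁ y) = y ≡ x
  Through x (inj₂ e) = x ∈e e

  -- the neighbours of u in C(G) correspond to the other vertices x: x itself or the edge ux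
  neighbourThrough : ∀ u x → x ≢ u → Σ W λ y → centAdj G (inj₁ u) y × Through x y
  neighbourThrough u x x≢u with adj G u x in u~x
  ... | true  = inj₂ (edge u x u~x) , ∈edgeˡ u x u~x , ∈edgeʳ u x u~x
  ... | false = inj₁ x , ((λ u≡x → x≢u (sym u≡x)) , u~x) , refl

  through-unique : ∀ {u x x′} y → x ≢ u → x′ ≢ u → centAdj G (inj₁ u) y →
                   Through x y → Through x′ y → x ≡ x′
  through-unique (inj₁ y) _ _ _ refl refl = refl
  through-unique (inj₂ e) x≢u x′≢u u∈e x∈e x′∈e with ∈e-two e (λ u≡x → x≢u (sym u≡x)) u∈e x∈e x′∈e
  ... | inj₁ x′≡u = ⊥-elim (x′≢u x′≡u)
  ... | inj₂ x′≡x = sym x′≡x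

  vertex-hasThreeNeighbours : 4 ≤ n → ∀ u → HasThreeNeighbours (centralGraph G) (inj₁ u)
  vertex-hasThreeNeighbours 4≤n u with threeOthers 4≤n u
  ... | x₁ , x₂ , x₃ , (x₁≢u , x₂≢u , x₃≢u) , (x₁≢x₂ , x₁≢x₃ , x₂≢x₃) =
    y x₁≢u , y x₂≢u , y x₃≢u ,
    (u∼y x₁≢u , u∼y x₂≢u , u∼y x₃≢u) ,
    (y-distinct x₁≢u x₂≢u x₁≢x₂ , y-distinct x₁≢u x₃≢u x₁≢x₃ , y-distinct x₂≢u x₃≢u x₂≢x₃)
    where
    y : ∀ {x} → x ≢ u → W
    y x≢u = proj₁ (neighbourThrough u _ x≢u)
    u∼y : ∀ {x} (x≢u : x ≢ u) → centAdj G (inj₁ u) (y x≢u)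
    u∼y x≢u = proj₁ (proj₂ (neighbourThrough u _ x≢u))
    y-distinct : ∀ {x x′} (x≢u : x ≢ u) (x′≢u : x′ ≢ u) → x ≢ x′ → y x≢u ≢ y x′≢u
    y-distinct x≢u x′≢u x≢x′ y≡y′ =
      x≢x′ (through-unique (y x′≢u) x≢u x′≢u (u∼y x′≢u)
              (subst (Through _) y≡y′ (proj₂ (proj₂ (neighbourThrough u _ x≢u))))
              (proj₂ (proj₂ (neighbourThrough u _ x′≢u))))

  edge-notThreeNeighbours : ∀ e → ¬ HasThreeNeighbours (centralGraph G) (inj₂ e)
  edge-notThreeNeighbours e (inj₁ a , inj₁ b , inj₁ c , (a∈ , b∈ , c∈) , (a≢b , a≢c , b≢c))
    with ∈e-pigeonhole e a∈ b∈ c∈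
  ... | inj₁ refl = a≢b refl
  ... | inj₂ (inj₁ refl) = a≢c refl
  ... | inj₂ (inj₂ refl) = b≢c refl
  edge-notThreeNeighbours e (inj₂ _ , _ , _ , (() , _) , _)
  edge-notThreeNeighbours e (inj₁ _ , inj₂ _ , _ , (_ , () , _) , _)
  edge-notThreeNeighbours e (inj₁ _ , inj₁ _ , inj₂ _ , (_ , _ , ()) , _)

  vertexPreserving : 4 ≤ n → ∀ (ψ : Aut (centralGraph G)) v e → app ψ (inj₁ v) ≢ inj₂ e
  vertexPreserving 4≤n ψ v e ψv≡e = edge-notThreeNeighbours e
    (subst (HasThreeNeighbours (centralGraph G)) ψv≡e
      (hasThreeNeighbours-invariant (centralGraph G) ψ (inj₁ v) (vertex-hasThreeNeighbours 4≤n v)))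

  autCentralGraph : 4 ≤ n → AutGroupIso ⟦ G ⟧ (centralGraph G)
  autCentralGraph 4≤n =
    extendIso (centAdj G) id id extend-preserves extend-reflects (vertexPreserving 4≤n)

-- Connected 2-regular graphs are cycles

module TwoRegularCycle {n : ℕ} (G : SimpleGraph n) (connected : Connected G)
  (twoRegular : ∀ v → HasExactlyTwoNeighbours ⟦ G ⟧ v) (x₀ : Fin n) where
  open Edges G
  open Walks G

  next : Fin n → Fin n → Fin n
  next a u with twoRegular u
  ... | p , q , _ with a Fin.≟ p
  ...   | yes _ = q
  ...   | no _  = p

  Adj-next : ∀ a u → Adj u (next a u)
  Adj-next a u with twoRegular u
  ... | p , q , _ , u~p , u~q , _ with a Fin.≟ p
  ...   | yes _ = u~q
  ...   | no _  = u~p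

  next≢ : ∀ a u → next a u ≢ a
  next≢ a u with twoRegular u
  ... | p , q , p≢q , _ with a Fin.≟ p
  ...   | yes a≡p = λ q≡a → p≢q (trans (sym a≡p) (sym q≡a))
  ...   | no a≢p  = λ p≡a → a≢p (sym p≡a)

  next-only : ∀ {a u w} → Adj u a → Adj u w → w ≡ a ⊎ w ≡ next a u
  next-only {a} {u} {w} u~a u~w with twoRegular u
  ... | p , q , _ , _ , _ , only with a Fin.≟ p | only w u~w
  ...   | yes a≡p | inj₁ w≡p = inj₁ (trans w≡p (sym a≡p))
  ...   | yes _   | inj₂ w≡q = inj₂ w≡q
  ...   | no _    | inj₁ w≡p = inj₂ w≡p
  ...   | no a≢p  | inj₂ w≡q with only a u~a
  ...     | inj₁ a≡p = ⊥-elim (a≢p a≡p)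
  ...     | inj₂ a≡q = inj₁ (trans w≡q (sym a≡q))

  -- consecutive pairs (x k , x (suc k)) of the non-backtracking walk from x₀
  steps : ℕ → Fin n × Fin n
  steps zero    = x₀ , proj₁ (twoRegular x₀)
  steps (suc k) = proj₂ (steps k) , next (proj₁ (steps k)) (proj₂ (steps k))

  x : ℕ → Fin n
  x k = proj₁ (steps k)

  x-adj : ∀ k → Adj (x k) (x (suc k))
  x-adj zero    = proj₁ (proj₂ (proj₂ (proj₂ (twoRegular x₀))))
  x-adj (suc k) = Adj-next (x k) (x (suc k))

  x-neighbours : ∀ k {w} → Adj (x (suc k)) w → w ≡ x k ⊎ w ≡ x (suc (suc k))
  x-neighbours k = next-only (Adj-sym (x-adj k))

  x-no-backtrack : ∀ k → x (suc (suc k)) ≢ x k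
  x-no-backtrack k = next≢ (x k) (x (suc k))

  Distinct : ℕ → Set
  Distinct N = ∀ {i j} → i < j → j ≤ N → x i ≢ x j

  distinct-injective : ∀ {N i j} → Distinct N → i ≤ N → j ≤ N → x i ≡ x j → i ≡ j
  distinct-injective {i = i} {j} distinct i≤N j≤N xi≡xj with ℕ.<-cmp i j
  ... | tri< i<j _ _ = ⊥-elim (distinct i<j j≤N xi≡xj)
  ... | tri≈ _ i≡j _ = i≡j
  ... | tri> _ _ j<i = ⊥-elim (distinct j<i i≤N (sym xi≡xj))

  Repeats : ℕ → Set
  Repeats M = Σ ℕ λ i → i ≤ M × x (suc M) ≡ x i

  distinct-suc : ∀ {N} → Distinct N → ¬ Repeats N → Distinct (suc N)
  distinct-suc distinct ¬repeats {i} {j} i<j j≤1+N with ℕ.m≤n⇒m<n∨m≡n j≤1+N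
  ... | inj₁ j<1+N = distinct i<j (ℕ.≤-pred j<1+N)
  ... | inj₂ refl  = λ xi≡xj → ¬repeats (i , ℕ.≤-pred i<j , sym xi≡xj)

  repeats? : ∀ N → Dec (Repeats N)
  repeats? N with Fin.any? (λ (i : Fin (suc N)) → x (suc N) Fin.≟ x (toℕ i))
  ... | yes (i , eq) = yes (toℕ i , ℕ.≤-pred (Fin.toℕ<n i) , eq)
  ... | no ¬repeats  = no λ (i , i≤N , eq) →
    ¬repeats (fromℕ< (s≤s i≤N) , subst (λ k → x (suc N) ≡ x k) (sym (Fin.toℕ-fromℕ< (s≤s i≤N))) eq)

  distinct-or-repeats : ∀ N → Distinct N ⊎ Σ ℕ λ M → Distinct M × Repeats M
  distinct-or-repeats zero = inj₁ λ { i<j z≤n → ⊥-elim (ℕ.n≮0 i<j) }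
  distinct-or-repeats (suc N) with distinct-or-repeats N
  ... | inj₂ repeat = inj₂ repeat
  ... | inj₁ distinct with repeats? N
  ...   | yes repeats = inj₂ (N , distinct , repeats)
  ...   | no ¬repeats = inj₁ (distinct-suc distinct ¬repeats)

  not-distinct : ¬ Distinct n
  not-distinct distinct = ℕ.n≮n n (Fin.injective⇒≤ {f = λ (i : Fin (suc n)) → x (toℕ i)} injective)
    where
    injective : ∀ {i j : Fin (suc n)} → x (toℕ i) ≡ x (toℕ j) → i ≡ j
    injective {i} {j} eq =
      Fin.toℕ-injective (distinct-injective distinct (ℕ.≤-pred (Fin.toℕ<n i)) (ℕ.≤-pred (Fin.toℕ<n j)) eq)

  firstRepeat : Σ ℕ λ M → Distinct M × Repeats M
  firstRepeat with distinct-or-repeats n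
  ... | inj₁ distinct = ⊥-elim (not-distinct distinct)
  ... | inj₂ repeat   = repeat

  -- If x (suc M) = x (suc i), then x M is a neighbour of x (suc i), so M = i + 2 by
  -- distinctness, and the walk would backtrack.
  repeat-at-start : ∀ {M i} → Distinct M → i ≤ M → x (suc M) ≡ x i → i ≡ 0
  repeat-at-start {i = zero} distinct 0≤M eq = refl
  repeat-at-start {M} {suc i} distinct 1+i≤M eq with suc i ℕ.≟ M
  ... | yes refl = ⊥-elim (Adj-irrefl (x-adj M) (sym eq))
  ... | no 1+i≢M with x-neighbours i (Adj-sym (subst (Adj (x M)) eq (x-adj M)))
  ...   | inj₁ xM≡xi = ⊥-elim (distinct 1+i≤M ℕ.≤-refl (sym xM≡xi))
  ...   | inj₂ xM≡x2+i with ℕ.m≤n⇒m<n∨m≡n (ℕ.≤∧≢⇒< 1+i≤M 1+i≢M)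
  ...     | inj₁ 2+i<M = ⊥-elim (distinct 2+i<M ℕ.≤-refl (sym xM≡x2+i))
  ...     | inj₂ refl  = ⊥-elim (x-no-backtrack (suc i) eq)

  module Closed (M : ℕ) (distinct : Distinct M) (closes : x (suc M) ≡ x 0) (1<M : 1 < M) where

    x₀~xM : Adj (x 0) (x M)
    x₀~xM = Adj-sym (subst (Adj (x M)) closes (x-adj M))

    x₀-neighbours : ∀ {w} → Adj (x 0) w → w ≡ x 1 ⊎ w ≡ x M
    x₀-neighbours x₀~w with next-only (x-adj 0) x₀~w | next-only (x-adj 0) x₀~xM
    ... | inj₁ w≡x₁ | _          = inj₁ w≡x₁
    ... | inj₂ _    | inj₁ xM≡x₁ = ⊥-elim (distinct 1<M ℕ.≤-refl (sym xM≡x₁))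
    ... | inj₂ w≡   | inj₂ xM≡   = inj₂ (trans w≡ (sym xM≡))

    OnCycle : Fin n → Set
    OnCycle y = Σ ℕ λ k → k ≤ M × x k ≡ y

    onCycle-step : ∀ {y z} → Adj y z → OnCycle y → OnCycle z
    onCycle-step y~z (zero , _ , refl) with x₀-neighbours y~z
    ... | inj₁ z≡x₁ = 1 , ℕ.<⇒≤ 1<M , sym z≡x₁
    ... | inj₂ z≡xM = M , ℕ.≤-refl , sym z≡xM
    onCycle-step y~z (suc k , 1+k≤M , refl) with x-neighbours k y~z
    ... | inj₁ z≡xk = k , ℕ.≤-trans (ℕ.n≤1+n k) 1+k≤M , sym z≡xk
    ... | inj₂ z≡x2+k with ℕ.m≤n⇒m<n∨m≡n 1+k≤M
    ...   | inj₁ 1+k<M = suc (suc k) , 1+k<M , sym z≡x2+k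
    ...   | inj₂ refl  = 0 , z≤n , sym (trans z≡x2+k closes)

    onCycle : ∀ y → OnCycle y
    onCycle y = walk-transport OnCycle onCycle-step (connected x₀ y) (0 , z≤n , refl)

    position : Fin n → ℕ
    position y = proj₁ (onCycle y)

    position≤M : ∀ y → position y ≤ M
    position≤M y = proj₁ (proj₂ (onCycle y))

    x-position : ∀ y → x (position y) ≡ y
    x-position y = proj₂ (proj₂ (onCycle y))

    x-injective : ∀ {k l} → k ≤ M → l ≤ M → x k ≡ x l → k ≡ l
    x-injective = distinct-injective distinct

    1+M≡n : suc M ≡ n
    1+M≡n = ℕ.≤-antisym
      (Fin.injective⇒≤ {f = λ (k : Fin (suc M)) → x (toℕ k)} λ {k} {l} eq →
         Fin.toℕ-injective (x-injective (ℕ.≤-pred (Fin.toℕ<n k)) (ℕ.≤-pred (Fin.toℕ<n l)) eq))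
      (Fin.injective⇒≤ {f = λ y → fromℕ< (s≤s (position≤M y))} λ {y} {z} eq → begin
         y                ≡⟨ sym (x-position y) ⟩
         x (position y)   ≡⟨ cong x (Fin.fromℕ<-injective _ _ (s≤s (position≤M y)) (s≤s (position≤M z)) eq) ⟩
         x (position z)   ≡⟨ x-position z ⟩
         z                ∎)
      where open ≡-Reasoning

    CycleAdj : ℕ → ℕ → Set
    CycleAdj k l = (suc k ≡ l) ⊎ (suc l ≡ k) ⊎ (k ≡ 0 × suc l ≡ n) ⊎ (l ≡ 0 × suc k ≡ n)

    Adj⇒CycleAdj : ∀ {k l} → k ≤ M → l ≤ M → Adj (x k) (x l) → CycleAdj k l
    Adj⇒CycleAdj {zero} {l} _ l≤M xk~xl with x₀-neighbours xk~xl
    ... | inj₁ xl≡x₁ = inj₁ (sym (x-injective l≤M (ℕ.<⇒≤ 1<M) xl≡x₁))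
    ... | inj₂ xl≡xM = inj₂ (inj₂ (inj₁ (refl , trans (cong suc (x-injective l≤M ℕ.≤-refl xl≡xM)) 1+M≡n)))
    Adj⇒CycleAdj {suc k} {l} 1+k≤M l≤M xk~xl with x-neighbours k xk~xl
    ... | inj₁ xl≡xk = inj₂ (inj₁ (cong suc (x-injective l≤M (ℕ.≤-trans (ℕ.n≤1+n k) 1+k≤M) xl≡xk)))
    ... | inj₂ xl≡x2+k with ℕ.m≤n⇒m<n∨m≡n 1+k≤M
    ...   | inj₁ 1+k<M = inj₁ (sym (x-injective l≤M 1+k<M xl≡x2+k))
    ...   | inj₂ refl  = inj₂ (inj₂ (inj₂ (x-injective l≤M z≤n (trans xl≡x2+k closes) , 1+M≡n)))

    CycleAdj⇒Adj : ∀ {k l} → CycleAdj k l → Adj (x k) (x l)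
    CycleAdj⇒Adj {k} (inj₁ refl) = x-adj k
    CycleAdj⇒Adj {l = l} (inj₂ (inj₁ refl)) = Adj-sym (x-adj l)
    CycleAdj⇒Adj (inj₂ (inj₂ (inj₁ (refl , 1+l≡n)))) =
      subst (λ j → Adj (x 0) (x j)) (ℕ.suc-injective (trans 1+M≡n (sym 1+l≡n))) x₀~xM
    CycleAdj⇒Adj (inj₂ (inj₂ (inj₂ (refl , 1+k≡n)))) =
      Adj-sym (subst (λ j → Adj (x 0) (x j)) (ℕ.suc-injective (trans 1+M≡n (sym 1+k≡n))) x₀~xM)

    toCycle : Fin n → Fin n
    toCycle y = fromℕ< (subst (position y ℕ.<_) 1+M≡n (s≤s (position≤M y)))

    toℕ-toCycle : ∀ y → toℕ (toCycle y) ≡ position y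
    toℕ-toCycle y = Fin.toℕ-fromℕ< (subst (position y ℕ.<_) 1+M≡n (s≤s (position≤M y)))

    fromCycle : Fin n → Fin n
    fromCycle i = x (toℕ i)

    toℕ≤M : ∀ (i : Fin n) → toℕ i ≤ M
    toℕ≤M i = ℕ.≤-pred (subst (toℕ i ℕ.<_) (sym 1+M≡n) (Fin.toℕ<n i))

    fromCycle-toCycle : ∀ y → fromCycle (toCycle y) ≡ y
    fromCycle-toCycle y = trans (cong x (toℕ-toCycle y)) (x-position y)

    toCycle-fromCycle : ∀ i → toCycle (fromCycle i) ≡ i
    toCycle-fromCycle i = Fin.toℕ-injective
      (trans (toℕ-toCycle (x (toℕ i))) (x-injective (position≤M _) (toℕ≤M i) (x-position (x (toℕ i)))))

    iso : GraphIso ⟦ G ⟧ (cycle n)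
    iso = graphIso {⟦ G ⟧} {cycle n} toCycle fromCycle toCycle-fromCycle fromCycle-toCycle
      (λ u v u~v → subst₂ CycleAdj (sym (toℕ-toCycle u)) (sym (toℕ-toCycle v))
                     (Adj⇒CycleAdj (position≤M u) (position≤M v)
                        (subst₂ Adj (sym (x-position u)) (sym (x-position v)) u~v)))
      (λ u v c → subst₂ Adj (fromCycle-toCycle u) (fromCycle-toCycle v) (CycleAdj⇒Adj c))

  cycleIso : GraphIso ⟦ G ⟧ (cycle n)
  cycleIso with firstRepeat
  ... | M , distinct , i , i≤M , closes with repeat-at-start distinct i≤M closes
  ...   | refl with M
  ...     | zero        = ⊥-elim (Adj-irrefl (x-adj 0) (sym closes))
  ...     | suc zero    = ⊥-elim (x-no-backtrack 0 closes)
  ...     | suc (suc m) = Closed.iso (suc (suc m)) distinct closes (s≤s (s≤s z≤n))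

-- The subdivision graph

module SubdivisionGraph {n : ℕ} (G : SimpleGraph n) where
  open Edges G
  open Induced G
  open VertexEdgeGraphs G
  open Walks G

  S : Graph
  S = subdivisionGraph G

  extend-preserves : ∀ σ x y → subAdj G x y → subAdj G (extend σ x) (extend σ y)
  extend-preserves σ (inj₁ u) (inj₂ e) = ∈edgeMap σ e
  extend-preserves σ (inj₂ e) (inj₁ u) = ∈edgeMap σ e

  extend-reflects : ∀ σ x y → subAdj G (extend σ x) (extend σ y) → subAdj G x y
  extend-reflects σ (inj₁ u) (inj₂ e) = app∈edgeMap⁻ σ e
  extend-reflects σ (inj₂ e) (inj₁ u) = app∈edgeMap⁻ σ e

  vertex-neighbour : ∀ {u} y → subAdj G (inj₁ u) y → Σ E λ f → y ≡ inj₂ f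
  vertex-neighbour (inj₂ f) _ = f , refl

  edge-neighbour : ∀ {e} y → subAdj G (inj₂ e) y → Σ (Fin n) λ z → y ≡ inj₁ z
  edge-neighbour (inj₁ z) _ = z , refl

  edge-hasExactlyTwoNeighbours : ∀ e → HasExactlyTwoNeighbours S (inj₂ e)
  edge-hasExactlyTwoNeighbours e =
    inj₁ (lo e) , inj₁ (hi e) , (λ eq → lo≢hi e (inj₁-injective eq)) , lo∈ e , hi∈ e , only
    where
    only : ∀ w → subAdj G (inj₂ e) w → w ≡ inj₁ (lo e) ⊎ w ≡ inj₁ (hi e)
    only (inj₁ z) (inj₁ z≡lo) = inj₁ (cong inj₁ z≡lo)
    only (inj₁ z) (inj₂ z≡hi) = inj₂ (cong inj₁ z≡hi)

  hasExactlyTwoNeighbours-fromS : ∀ v → HasExactlyTwoNeighbours S (inj₁ v) → HasExactlyTwoNeighbours ⟦ G ⟧ v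
  hasExactlyTwoNeighbours-fromS v (inj₂ f , inj₂ g , f≢g , v∈f , v∈g , only) =
    other f v , other g v , other-distinct , Adj-other f v∈f , Adj-other g v∈g , only′
    where
    other-distinct : other f v ≢ other g v
    other-distinct eq = f≢g (cong inj₂ (edge-unique (λ v≡ → other≢ f v∈f (sym v≡))
      v∈f (other∈ f v) v∈g (subst (_∈e g) (sym eq) (other∈ g v))))
    other-of : ∀ {w} (v~w : Adj v w) h → v ∈e h → inj₂ (edge v w v~w) ≡ inj₂ h → w ≡ other h v
    other-of {w} v~w h v∈h refl with ∈e-other h v∈h (∈edgeʳ v w v~w)
    ... | inj₁ w≡v = ⊥-elim (Adj-irrefl v~w (sym w≡v))
    ... | inj₂ w≡  = w≡
    only′ : ∀ w → Adj v w → w ≡ other f v ⊎ w ≡ other g v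
    only′ w v~w with only (inj₂ (edge v w v~w)) (∈edgeˡ v w v~w)
    ... | inj₁ vw≡f = inj₁ (other-of v~w f v∈f vw≡f)
    ... | inj₂ vw≡g = inj₂ (other-of v~w g v∈g vw≡g)

  -- ψ maps the path u, uv, v of S(G) to a path edge, vertex, edge
  vertexToEdge-spreads : ∀ (ψ : Aut S) {u v} → Adj u v →
                         Σ E (λ e → app ψ (inj₁ u) ≡ inj₂ e) → Σ E (λ f → app ψ (inj₁ v) ≡ inj₂ f)
  vertexToEdge-spreads ψ {u} {v} u~v (e , ψu≡e)
    with edge-neighbour (app ψ (inj₂ h)) (subst (λ y → subAdj G y (app ψ (inj₂ h))) ψu≡e
                                           (preserve ψ (inj₁ u) (inj₂ h) (∈edgeˡ u v u~v)))
    where h = edge u v u~v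
  ... | z , ψh≡z = vertex-neighbour (app ψ (inj₁ v))
                     (subst (λ y → subAdj G y (app ψ (inj₁ v))) ψh≡z
                       (preserve ψ (inj₂ (edge u v u~v)) (inj₁ v) (∈edgeʳ u v u~v)))

  vertexToEdge⇒twoRegular : Connected G → ∀ (ψ : Aut S) u e → app ψ (inj₁ u) ≡ inj₂ e →
                               ∀ v → HasExactlyTwoNeighbours ⟦ G ⟧ v
  vertexToEdge⇒twoRegular connected ψ u e ψu≡e v
    with walk-transport (λ w → Σ E λ f → app ψ (inj₁ w) ≡ inj₂ f) (vertexToEdge-spreads ψ)
                        (connected u v) (e , ψu≡e)
  ... | f , ψv≡f = hasExactlyTwoNeighbours-fromS v
    (subst (HasExactlyTwoNeighbours S) ψ⁻¹f≡v
      (hasExactlyTwoNeighbours-invariant S (invAut ψ) (inj₂ f) (edge-hasExactlyTwoNeighbours f)))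
    where
    ψ⁻¹f≡v : app⁻¹ ψ (inj₂ f) ≡ inj₁ v
    ψ⁻¹f≡v = trans (cong (app⁻¹ ψ) (sym ψv≡f)) (app⁻¹-app ψ (inj₁ v))

  vertexPreserving : Connected G → ¬ GraphIso ⟦ G ⟧ (cycle n) →
                     ∀ (ψ : Aut S) v e → app ψ (inj₁ v) ≢ inj₂ e
  vertexPreserving connected notCycle ψ v e ψv≡e =
    notCycle (TwoRegularCycle.cycleIso G connected (vertexToEdge⇒twoRegular connected ψ v e ψv≡e) v)

  autSubdivisionGraph : Connected G → ¬ GraphIso ⟦ G ⟧ (cycle n) → AutGroupIso ⟦ G ⟧ S
  autSubdivisionGraph connected notCycle =
    extendIso (subAdj G) id id extend-preserves extend-reflects (vertexPreserving connected notCycle)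

-- The line graph

OneOrThree : Set → Set → Set → Set
OneOrThree A B C = (A × ¬ B × ¬ C) ⊎ (¬ A × B × ¬ C) ⊎ (¬ A × ¬ B × C) ⊎ (A × B × C)

oneOrThree-⇔ : ∀ {A A′ B B′ C C′} → A ⇔ A′ → B ⇔ B′ → C ⇔ C′ → OneOrThree A B C → OneOrThree A′ B′ C′
oneOrThree-⇔ A⇔ B⇔ C⇔ (inj₁ (a , ¬b , ¬c)) =
  inj₁ (Equivalence.to A⇔ a , ¬b ∘ Equivalence.from B⇔ , ¬c ∘ Equivalence.from C⇔)
oneOrThree-⇔ A⇔ B⇔ C⇔ (inj₂ (inj₁ (¬a , b , ¬c))) =
  inj₂ (inj₁ (¬a ∘ Equivalence.from A⇔ , Equivalence.to B⇔ b , ¬c ∘ Equivalence.from C⇔))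
oneOrThree-⇔ A⇔ B⇔ C⇔ (inj₂ (inj₂ (inj₁ (¬a , ¬b , c)))) =
  inj₂ (inj₂ (inj₁ (¬a ∘ Equivalence.from A⇔ , ¬b ∘ Equivalence.from B⇔ , Equivalence.to C⇔ c)))
oneOrThree-⇔ A⇔ B⇔ C⇔ (inj₂ (inj₂ (inj₂ (a , b , c)))) =
  inj₂ (inj₂ (inj₂ (Equivalence.to A⇔ a , Equivalence.to B⇔ b , Equivalence.to C⇔ c)))

module LineGraph {n : ℕ} (G : SimpleGraph n) (5≤n : 5 ≤ n) (connected : Connected G) where
  open Edges G
  open Induced G
  open Walks G

  L : Graph
  L = lineGraph G

  HasOddNeighbour : E → E → E → Set
  HasOddNeighbour e f g = Σ E λ h → OneOrThree (Meets h e) (Meets h f) (Meets h g)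

  hasOddNeighbour-invariant : ∀ (ψ : Aut L) {e f g} → HasOddNeighbour e f g →
                              HasOddNeighbour (app ψ e) (app ψ f) (app ψ g)
  hasOddNeighbour-invariant ψ (h , odd) = app ψ h , oneOrThree-⇔ meets⇔ meets⇔ meets⇔ odd
    where
    meets⇔ : ∀ {k} → Meets h k ⇔ Meets (app ψ h) (app ψ k)
    meets⇔ = mk⇔ (preserve ψ _ _) (reflect ψ _ _)

  ¬Meets-sharingTwo : ∀ {h k x y} → x ≢ y → x ∈e h → y ∈e h → x ∈e k → y ∈e k → ¬ Meets h k
  ¬Meets-sharingTwo x≢y x∈h y∈h x∈k y∈k (h≢k , _) = h≢k (edge-unique x≢y x∈h y∈h x∈k y∈k)

  record Triangle (e f g : E) (x y z : Fin n) : Set where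
    field
      x∈e : x ∈e e
      z∈e : z ∈e e
      x∈f : x ∈e f
      y∈f : y ∈e f
      y∈g : y ∈e g
      z∈g : z ∈e g
      x∉g : ¬ x ∈e g
      y∉e : ¬ y ∈e e
      z∉f : ¬ z ∈e f

    x≢z : x ≢ z
    x≢z refl = x∉g z∈g

    x≢y : x ≢ y
    x≢y refl = y∉e x∈e

    y≢z : y ≢ z
    y≢z refl = y∉e z∈e

    f≢g : f ≢ g
    f≢g refl = x∉g x∈f

    Meets-fg : Meets f g
    Meets-fg = meets f≢g y∈f y∈g

  rotate : ∀ {e f g x y z} → Triangle e f g x y z → Triangle f g e y z x
  rotate t = record
    { x∈e = y∈f ; z∈e = x∈f ; x∈f = y∈g ; y∈f = z∈g ; y∈g = z∈e ; z∈g = x∈e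
    ; x∉g = y∉e ; y∉e = z∉f ; z∉f = x∉g }
    where open Triangle t

  triangle-¬one : ∀ {e f g x y z h} → Triangle e f g x y z → Meets h e → ¬ Meets h f → ¬ Meets h g → ⊥
  triangle-¬one {e} {f} {g} {h = h} t (_ , w , w∈h , w∈e) ¬h~f ¬h~g
    with ∈e-two e (Triangle.x≢z t) (Triangle.x∈e t) (Triangle.z∈e t) w∈e | h ≟e f | h ≟e g
  ... | inj₁ _    | yes refl | _        = ¬h~g (Triangle.Meets-fg t)
  ... | inj₁ refl | no h≢f   | _        = ¬h~f (meets h≢f w∈h (Triangle.x∈f t))
  ... | inj₂ _    | _        | yes refl = ¬h~f (Meets-sym (Triangle.Meets-fg t))
  ... | inj₂ refl | _        | no h≢g   = ¬h~g (meets h≢g w∈h (Triangle.z∈g t))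

  triangle-¬three : ∀ {e f g x y z h} → Triangle e f g x y z → Meets h e → Meets h f → Meets h g → ⊥
  triangle-¬three {e} {f} {g} t h~e@(_ , w₁ , w₁∈h , w₁∈e) h~f@(_ , w₂ , w₂∈h , w₂∈f) h~g@(_ , w₃ , w₃∈h , w₃∈g)
    with ∈e-two e (Triangle.x≢z t) (Triangle.x∈e t) (Triangle.z∈e t) w₁∈e
       | ∈e-two f (Triangle.x≢y t) (Triangle.x∈f t) (Triangle.y∈f t) w₂∈f
       | ∈e-two g (Triangle.y≢z t) (Triangle.y∈g t) (Triangle.z∈g t) w₃∈g
  ... | inj₁ refl | _         | inj₁ refl = ¬Meets-sharingTwo (Triangle.x≢y t) w₁∈h w₃∈h (Triangle.x∈f t) (Triangle.y∈f t) h~f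
  ... | inj₁ refl | _         | inj₂ refl = ¬Meets-sharingTwo (Triangle.x≢z t) w₁∈h w₃∈h (Triangle.x∈e t) (Triangle.z∈e t) h~e
  ... | inj₂ refl | inj₁ refl | _         = ¬Meets-sharingTwo (Triangle.x≢z t) w₂∈h w₁∈h (Triangle.x∈e t) (Triangle.z∈e t) h~e
  ... | inj₂ refl | inj₂ refl | _         = ¬Meets-sharingTwo (Triangle.y≢z t) w₂∈h w₁∈h (Triangle.y∈g t) (Triangle.z∈g t) h~g

  triangle-¬oddNeighbour : ∀ {e f g x y z} → Triangle e f g x y z → ¬ HasOddNeighbour e f g
  triangle-¬oddNeighbour t (h , inj₁ (h~e , ¬h~f , ¬h~g)) = triangle-¬one t h~e ¬h~f ¬h~g
  triangle-¬oddNeighbour t (h , inj₂ (inj₁ (¬h~e , h~f , ¬h~g))) = triangle-¬one (rotate t) h~f ¬h~g ¬h~e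
  triangle-¬oddNeighbour t (h , inj₂ (inj₂ (inj₁ (¬h~e , ¬h~f , h~g)))) =
    triangle-¬one (rotate (rotate t)) h~g ¬h~e ¬h~f
  triangle-¬oddNeighbour t (h , inj₂ (inj₂ (inj₂ (h~e , h~f , h~g)))) = triangle-¬three t h~e h~f h~g

  -- three pairwise meeting edges form a star or a triangle, and triangles have no odd neighbour
  commonVertex : ∀ {e f g} → Meets e f → Meets f g → Meets e g → HasOddNeighbour e f g →
                 Σ (Fin n) λ w → w ∈e e × w ∈e f × w ∈e g
  commonVertex {e} {f} {g} (_ , x , x∈e , x∈f) (_ , y , y∈f , y∈g) (_ , z , z∈e , z∈g) odd
    with x ∈e? g | y ∈e? e | z ∈e? f
  ... | yes x∈g | _       | _       = x , x∈e , x∈f , x∈g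
  ... | no _    | yes y∈e | _       = y , y∈e , y∈f , y∈g
  ... | no _    | no _    | yes z∈f = z , z∈e , z∈f , z∈g
  ... | no x∉g  | no y∉e  | no z∉f  = ⊥-elim (triangle-¬oddNeighbour (record
    { x∈e = x∈e ; z∈e = z∈e ; x∈f = x∈f ; y∈f = y∈f ; y∈g = y∈g ; z∈g = z∈g
    ; x∉g = x∉g ; y∉e = y∉e ; z∉f = z∉f }) odd)

  endsIn : ∀ {xs : List (Fin n)} {v} e → v ∈e e → v ∈ xs → other e v ∈ xs → ∀ {w} → w ∈e e → w ∈ xs
  endsIn e v∈e v∈xs o∈xs w∈e with ∈e-other e v∈e w∈e
  ... | inj₁ refl = v∈xs
  ... | inj₂ refl = o∈xs

  ∈e⇔Meets-exit : ∀ {xs y z k} (y~z : Adj y z) → z ∉ xs → (∀ {w} → w ∈e k → w ∈ xs) →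
                  y ∈e k ⇔ Meets (edge y z y~z) k
  ∈e⇔Meets-exit {y = y} {z} {k} y~z z∉xs k⊆xs = mk⇔ to from
    where
    to : y ∈e k → Meets (edge y z y~z) k
    to y∈k = meets (λ h≡k → z∉xs (k⊆xs (subst (z ∈e_) h≡k (∈edgeʳ y z y~z)))) (∈edgeˡ y z y~z) y∈k
    from : Meets (edge y z y~z) k → y ∈e k
    from (_ , w , w∈h , w∈k) with ∈edge⁻ y z y~z w∈h
    ... | inj₁ refl = w∈k
    ... | inj₂ refl = ⊥-elim (z∉xs (k⊆xs w∈k))

  other∉ : ∀ {v e f} → v ∈e e → v ∈e f → e ≢ f → ¬ other e v ∈e f
  other∉ {v} {e} v∈e v∈f e≢f o∈f = e≢f (edge-unique (other≢ e v∈e) (other∈ e v) v∈e o∈f v∈f)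

  -- n ≥ 5, so some edge leaves the four vertices of the star; it meets one or all three of its edges
  star-hasOddNeighbour : ∀ {v e f g} → v ∈e e → v ∈e f → v ∈e g → e ≢ f → e ≢ g → f ≢ g →
                         HasOddNeighbour e f g
  star-hasOddNeighbour {v} {e} {f} {g} v∈e v∈f v∈g e≢f e≢g f≢g = odd (edgeLeaving connected xs 5≤n (here refl))
    where
    xs : List (Fin n)
    xs = v ∷ other e v ∷ other f v ∷ other g v ∷ []
    oneOrThree : ∀ {y} → y ∈ xs → OneOrThree (y ∈e e) (y ∈e f) (y ∈e g)
    oneOrThree (here refl) = inj₂ (inj₂ (inj₂ (v∈e , v∈f , v∈g)))
    oneOrThree (there (here refl)) =
      inj₁ (other∈ e v , other∉ v∈e v∈f e≢f , other∉ v∈e v∈g e≢g)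
    oneOrThree (there (there (here refl))) =
      inj₂ (inj₁ (other∉ v∈f v∈e (≢-sym e≢f) , other∈ f v , other∉ v∈f v∈g f≢g))
    oneOrThree (there (there (there (here refl)))) =
      inj₂ (inj₂ (inj₁ (other∉ v∈g v∈e (≢-sym e≢g) , other∉ v∈g v∈f (≢-sym f≢g) , other∈ g v)))
    odd : (Σ (Fin n) λ y → Σ (Fin n) λ z → y ∈ xs × z ∉ xs × Adj y z) → HasOddNeighbour e f g
    odd (y , z , y∈xs , z∉xs , y~z) = edge y z y~z , oneOrThree-⇔
      (∈e⇔Meets-exit y~z z∉xs (endsIn e v∈e (here refl) (there (here refl))))
      (∈e⇔Meets-exit y~z z∉xs (endsIn f v∈f (here refl) (there (there (here refl)))))
      (∈e⇔Meets-exit y~z z∉xs (endsIn g v∈g (here refl) (there (there (there (here refl))))))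
      (oneOrThree y∈xs)

  starImage : ∀ (ψ : Aut L) {v e f g} → v ∈e e → v ∈e f → v ∈e g → e ≢ f → e ≢ g → f ≢ g →
              Σ (Fin n) λ w → w ∈e app ψ e × w ∈e app ψ f × w ∈e app ψ g
  starImage ψ v∈e v∈f v∈g e≢f e≢g f≢g =
    commonVertex (preserve ψ _ _ (meets e≢f v∈e v∈f)) (preserve ψ _ _ (meets f≢g v∈f v∈g))
                 (preserve ψ _ _ (meets e≢g v∈e v∈g))
                 (hasOddNeighbour-invariant ψ (star-hasOddNeighbour v∈e v∈f v∈g e≢f e≢g f≢g))

  MapsStar : Aut L → Fin n → Fin n → Set
  MapsStar ψ v w = ∀ g → v ∈e g ⇔ w ∈e app ψ g

  star-forward : ∀ (ψ : Aut L) {v w e f} → v ∈e e → v ∈e f → e ≢ f → w ∈e app ψ e → w ∈e app ψ f →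
                 ∀ g → v ∈e g → w ∈e app ψ g
  star-forward ψ {e = e} {f} v∈e v∈f e≢f w∈ψe w∈ψf g v∈g with g ≟e e | g ≟e f
  ... | yes refl | _        = w∈ψe
  ... | no _     | yes refl = w∈ψf
  ... | no g≢e   | no g≢f with starImage ψ v∈e v∈f v∈g e≢f (≢-sym g≢e) (≢-sym g≢f)
  ...   | w′ , w′∈ψe , w′∈ψf , w′∈ψg =
    subst (_∈e app ψ g) (common-unique (λ eq → e≢f (app-injective ψ eq)) w′∈ψe w′∈ψf w∈ψe w∈ψf) w′∈ψg

  mapsStar-twoEdges : ∀ (ψ : Aut L) {v e f} → v ∈e e → v ∈e f → e ≢ f → Σ (Fin n) (MapsStar ψ v)
  mapsStar-twoEdges ψ {v} {e} {f} v∈e v∈f e≢f with preserve ψ e f (meets e≢f v∈e v∈f)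
  ... | ψe≢ψf , w , w∈ψe , w∈ψf = w , λ g → mk⇔ (star-forward ψ v∈e v∈f e≢f w∈ψe w∈ψf g) (backward g)
    where
    v∈ψ⁻¹ψ : ∀ {k} → v ∈e k → v ∈e app⁻¹ ψ (app ψ k)
    v∈ψ⁻¹ψ {k} = subst (v ∈e_) (sym (app⁻¹-app ψ k))
    backward : ∀ g → w ∈e app ψ g → v ∈e g
    backward g w∈ψg = subst (v ∈e_) (app⁻¹-app ψ g)
      (star-forward (invAut ψ) w∈ψe w∈ψf ψe≢ψf (v∈ψ⁻¹ψ v∈e) (v∈ψ⁻¹ψ v∈f) (app ψ g) w∈ψg)

  leaf-otherEdge : ∀ {v e} → v ∈e e → (∀ g → v ∈e g → g ≡ e) → Σ E λ f → other e v ∈e f × f ≢ e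
  leaf-otherEdge {v} {e} v∈e onlyEdge = otherEdge (edgeLeaving connected xs (ℕ.≤-trans (s≤s (s≤s (s≤s z≤n))) 5≤n) (here refl))
    where
    xs : List (Fin n)
    xs = v ∷ other e v ∷ []
    e⊆xs : ∀ {w} → w ∈e e → w ∈ xs
    e⊆xs = endsIn e v∈e (here refl) (there (here refl))
    otherEdge : (Σ (Fin n) λ y → Σ (Fin n) λ z → y ∈ xs × z ∉ xs × Adj y z) → Σ E λ f → other e v ∈e f × f ≢ e
    otherEdge (y , z , here refl , z∉xs , v~z) =
      ⊥-elim (z∉xs (e⊆xs (subst (z ∈e_) (onlyEdge (edge v z v~z) (∈edgeˡ v z v~z)) (∈edgeʳ v z v~z))))
    otherEdge (y , z , there (here refl) , z∉xs , y~z) =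
      edge y z y~z , ∈edgeˡ y z y~z , λ f≡e → z∉xs (e⊆xs (subst (z ∈e_) f≡e (∈edgeʳ y z y~z)))

  mapsStar-leaf : ∀ (ψ : Aut L) {v e} → v ∈e e → (∀ g → v ∈e g → g ≡ e) → Σ (Fin n) (MapsStar ψ v)
  mapsStar-leaf ψ {v} {e} v∈e onlyEdge with leaf-otherEdge v∈e onlyEdge
  ... | f , u∈f , f≢e with mapsStar-twoEdges ψ (other∈ e v) u∈f (≢-sym f≢e)
  ...   | w , u↦w = q , λ g → mk⇔ (forward g) (backward g)
    where
    q : Fin n
    q = other (app ψ e) w
    w∈ψe : w ∈e app ψ e
    w∈ψe = Equivalence.to (u↦w e) (other∈ e v)
    forward : ∀ g → v ∈e g → q ∈e app ψ g
    forward g v∈g = subst (λ k → q ∈e app ψ k) (sym (onlyEdge g v∈g)) (other∈ (app ψ e) w)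
    backward : ∀ g → q ∈e app ψ g → v ∈e g
    backward g q∈ψg with app ψ g ≟e app ψ e
    ... | yes ψg≡ψe = subst (v ∈e_) (sym (app-injective ψ ψg≡ψe)) v∈e
    ... | no ψg≢ψe with reflect ψ g e (meets ψg≢ψe q∈ψg (other∈ (app ψ e) w))
    ...   | _ , r , r∈g , r∈e with ∈e-other e v∈e r∈e
    ...     | inj₁ refl = r∈g
    ...     | inj₂ refl = ⊥-elim (ψg≢ψe (edge-unique (other≢ (app ψ e) w∈ψe)
                            q∈ψg (Equivalence.to (u↦w g) r∈g) (other∈ (app ψ e) w) w∈ψe))

  firstEdge : ∀ v → Σ E (v ∈e_)
  firstEdge v with edgeLeaving connected (v ∷ []) (ℕ.≤-trans (s≤s (s≤s z≤n)) 5≤n) (here refl)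
  ... | y , z , here refl , _ , v~z = edge v z v~z , ∈edgeˡ v z v~z

  mapsStar : ∀ (ψ : Aut L) v → Σ (Fin n) (MapsStar ψ v)
  mapsStar ψ v with firstEdge v
  ... | e , v∈e with Fin.any? (λ z → (adj G v z Bool.≟ true) ×-dec ¬? (z Fin.≟ other e v))
  ...   | yes (z , v~z , z≢o) = mapsStar-twoEdges ψ v∈e (∈edgeˡ v z v~z) e≢vz
    where
    e≢vz : e ≢ edge v z v~z
    e≢vz e≡vz with ∈e-other e v∈e (subst (z ∈e_) (sym e≡vz) (∈edgeʳ v z v~z))
    ... | inj₁ z≡v = Adj-irrefl v~z (sym z≡v)
    ... | inj₂ z≡o = z≢o z≡o
  ...   | no ¬secondEdge = mapsStar-leaf ψ v∈e onlyEdge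
    where
    onlyEdge : ∀ g → v ∈e g → g ≡ e
    onlyEdge g v∈g with other g v Fin.≟ other e v
    ... | yes o≡o = edge-unique (other≢ g v∈g) (other∈ g v) v∈g (subst (_∈e e) (sym o≡o) (other∈ e v)) v∈e
    ... | no o≢o  = ⊥-elim (¬secondEdge (other g v , Adj-other g v∈g , o≢o))

  sameStar⇒≡ : ∀ {w w′} → (∀ g → w ∈e g ⇔ w′ ∈e g) → w ≡ w′
  sameStar⇒≡ {w} {w′} same with w Fin.≟ w′
  ... | yes w≡w′ = w≡w′
  ... | no w≢w′ with edgeLeaving connected (w ∷ w′ ∷ []) (ℕ.≤-trans (s≤s (s≤s (s≤s z≤n))) 5≤n) (here refl)
  ...   | y , z , here refl , z∉ , w~z with ∈edge⁻ w z w~z (Equivalence.to (same (edge w z w~z)) (∈edgeˡ w z w~z))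
  ...     | inj₁ w′≡w = ⊥-elim (w≢w′ (sym w′≡w))
  ...     | inj₂ w′≡z = ⊥-elim (z∉ (there (here (sym w′≡z))))
  sameStar⇒≡ {w} {w′} same | no w≢w′ | y , z , there (here refl) , z∉ , w′~z
    with ∈edge⁻ w′ z w′~z (Equivalence.from (same (edge w′ z w′~z)) (∈edgeˡ w′ z w′~z))
  ...     | inj₁ w≡w′ = ⊥-elim (w≢w′ w≡w′)
  ...     | inj₂ w≡z  = ⊥-elim (z∉ (here (sym w≡z)))

  mapsStar-functional : ∀ (ψ : Aut L) {v w w′} → MapsStar ψ v w → MapsStar ψ v w′ → w ≡ w′
  mapsStar-functional ψ v↦w v↦w′ = sameStar⇒≡ λ h →
    subst (λ k → _ ∈e k ⇔ _ ∈e k) (app-app⁻¹ ψ h) (⇔.trans (⇔.sym (v↦w (app⁻¹ ψ h))) (v↦w′ (app⁻¹ ψ h)))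

  mapsStar-inverse : ∀ (ψ : Aut L) {v w} → MapsStar ψ v w → MapsStar (invAut ψ) w v
  mapsStar-inverse ψ {v} {w} v↦w g =
    subst (λ k → w ∈e k ⇔ v ∈e app⁻¹ ψ g) (app-app⁻¹ ψ g) (⇔.sym (v↦w (app⁻¹ ψ g)))

  mapsStar-lineAut : ∀ (σ : Aut ⟦ G ⟧) v → MapsStar (lineAut σ) v (app σ v)
  mapsStar-lineAut σ v g = mk⇔ (∈edgeMap σ g) (app∈edgeMap⁻ σ g)

  liftLineAut : ∀ (ψ : Aut L) → Σ (Aut ⟦ G ⟧) λ σ → ∀ e → edgeMap σ e ≡ app ψ e
  liftLineAut ψ = σ , edgeMap-incidenceAut
    where
    f g : Fin n → Fin n
    f v = proj₁ (mapsStar ψ v)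
    g v = proj₁ (mapsStar (invAut ψ) v)
    fg : ∀ v → f (g v) ≡ v
    fg v = mapsStar-functional ψ (proj₂ (mapsStar ψ (g v))) (mapsStar-inverse (invAut ψ) (proj₂ (mapsStar (invAut ψ) v)))
    gf : ∀ v → g (f v) ≡ v
    gf v = mapsStar-functional (invAut ψ) (proj₂ (mapsStar (invAut ψ) (f v))) (mapsStar-inverse ψ (proj₂ (mapsStar ψ v)))
    open FromIncidence f g fg gf (app ψ) (app⁻¹ ψ)
           (λ {v} {e} → Equivalence.to (proj₂ (mapsStar ψ v) e))
           (λ {v} {e} → Equivalence.to (proj₂ (mapsStar (invAut ψ) v) e))
           renaming (incidenceAut to σ)

  lineAut-injective : ∀ (σ τ : Aut ⟦ G ⟧) → _≈A_ {L} (lineAut σ) (lineAut τ) → _≈A_ {⟦ G ⟧} σ τ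
  lineAut-injective σ τ σ≈τ v = mapsStar-functional (lineAut σ) (mapsStar-lineAut σ v)
    (λ g → subst (λ k → v ∈e g ⇔ app τ v ∈e k) (sym (σ≈τ g)) (mapsStar-lineAut τ v g))

  autLineGraph : AutGroupIso ⟦ G ⟧ L
  autLineGraph = record
    { φ      = lineAut
    ; φ-cong = edgeMap-cong
    ; φ-hom  = edgeMap-∘
    ; φ-inj  = lineAut-injective
    ; φ-surj = liftLineAut
    }

theorem2p11 : (n : ℕ) → 5 ≤ n → (G : SimpleGraph n) → Connected G
    → ¬ GraphIso ⟦ G ⟧ (cycle n)
    → AutGroupIso ⟦ G ⟧ (lineGraph G)
      × AutGroupIso ⟦ G ⟧ (subdivisionGraph G)
      × AutGroupIso ⟦ G ⟧ (centralGraph G)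
      × AutGroupIso ⟦ G ⟧ (middleGraph G)
theorem2p11 n 5≤n G connected notCycle =
    LineGraph.autLineGraph G 5≤n connected
  , SubdivisionGraph.autSubdivisionGraph G connected notCycle
  , CentralGraph.autCentralGraph G (ℕ.<⇒≤ 5≤n)
  , MiddleGraph.autMiddleGraph G
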